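{- Let $n\ge 5$, let $\Gamma$ be the subgraph of $\mathrm{Cay}(\mathrm{Sym}_n,T_n)$ induced on $T_n$, and let $V$ be the set of all endpoints of the edges $e_0,\dots,e_n$, where $e_l=\{\sigma(l,l+1,l+3),\sigma(l,l+2,l+3)\}$ for $0\le l\le n-3$, $e_{n-2}=\{\sigma(0,n-2,n-1),\sigma(0,n-2,n)\}$, $e_{n-1}=\{\sigma(1,n-1,n),\sigma(0,1,n-1)\}$, $e_n=\{\sigma(0,2,n),\sigma(1,2,n)\}$. Then the induced subgraph $\Gamma(V)$ is Hamiltonian.
   Context: $\mathrm{Sym}_n$ is the symmetric group on $[n]$, permutations in one-line notation, $(\pi\circ\rho)(t)=\pi(\rho(t))$. For integers $0\le i<j<k\le n$ the block transposition $\sigma(i,j,k)$ is the permutation $[1\cdots i\ \ j+1\cdots k\ \ i+1\cdots j\ \ k+1\cdots n]$; $T_n$ is the set of all block transpositions. $\mathrm{Cay}(\mathrm{Sym}_n,T_n)$ has vertex set $\mathrm{Sym}_n$, with $\pi\sim\rho$ iff $\rho=\pi\circ\sigma$ for some $\sigma\in T_n$. -}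

module Defs where

open import Data.Nat using (ℕ; zero; suc; _+_; _∸_; _<_; _≤_)
open import Data.List using (List; []; _∷_; _++_; map; applyUpTo; concatMap; take; length)
open import Data.List.Membership.Propositional using (_∈_)
open import Data.List.Relation.Unary.Unique.Propositional using (Unique)
open import Data.Product using (Σ; ∃; _×_; _,_)
open import Data.Unit using (⊤)
open import Relation.Binary.PropositionalEquality using (_≡_)

-- A permutation of [n] in one-line notation: the list [π(1), …, π(n)] of values in 1..n.
Perm : Set
Perm = List ℕ

-- π(t) for a one-line list, 1-indexed (value 0 outside the range [1, length π]).
at : Perm → ℕ → ℕ
at []       _             = 0
at (x ∷ xs) zero          = 0
at (x ∷ xs) (suc zero)    = x
at (x ∷ xs) (suc (suc t)) = at xs (suc t)

_∘ₚ_ : Perm → Perm → Perm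
π ∘ₚ ρ = map (at π) ρ

-- interval a b = [a+1, a+2, …, b]  (empty if b ≤ a)
interval : ℕ → ℕ → List ℕ
interval a b = applyUpTo (λ t → suc (a + t)) (b ∸ a)

σ : (n i j k : ℕ) → Perm
σ n i j k = interval 0 i ++ interval j k ++ interval i j ++ interval k n

IsBT : ℕ → Perm → Set
IsBT n π = Σ ℕ λ i → Σ ℕ λ j → Σ ℕ λ k → (i < j) × (j < k) × (k ≤ n) × (π ≡ σ n i j k)

CayAdj : ℕ → Perm → Perm → Set
CayAdj n π ρ = Σ Perm λ s → IsBT n s × (ρ ≡ π ∘ₚ s)

Chain : (Perm → Perm → Set) → List Perm → Set
Chain R []           = ⊤
Chain R (x ∷ [])     = ⊤
Chain R (x ∷ y ∷ ys) = R x y × Chain R (y ∷ ys)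

Hamiltonian : (Perm → Perm → Set) → List Perm → Set
Hamiltonian R Vs =
  Σ (List Perm) λ c →
    (3 ≤ length c) × Unique c
    × (∀ v → v ∈ c → v ∈ Vs) × (∀ v → v ∈ Vs → v ∈ c)
    × Chain R (c ++ take 1 c)

edges : ℕ → List (Perm × Perm)
edges n =
  applyUpTo (λ l → σ n l (l + 1) (l + 3) , σ n l (l + 2) (l + 3)) (suc (n ∸ 3))
  ++ (σ n 0 (n ∸ 2) (n ∸ 1) , σ n 0 (n ∸ 2) n)
  ∷ (σ n 1 (n ∸ 1) n , σ n 0 1 (n ∸ 1))
  ∷ (σ n 0 2 n , σ n 1 2 n)
  ∷ []

Vset : ℕ → List Perm
Vset n = concatMap (λ { (a , b) → a ∷ b ∷ [] }) (edges n)

-- The cycle runs along e₀, …, e_{n−3}, crossing each edge from its second endpoint to its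
-- first (σ(l,l+2,l+3) → σ(l,l+1,l+3) → σ(l+1,l+3,l+4)), and returns to σ(0,2,3) through
-- the endpoints of e_{n−2}, e_{n−1}, e_n.  Every adjacency it uses is the inflation of an
-- adjacency between block transpositions of Sym₃, Sym₄ or Sym₅, checked by evaluation:
-- replacing each value u of a permutation by a block of w_u consecutive values is
-- compatible with composition and sends block transpositions to block transpositions.
-- The vertices are distinct because (i, j, k) can be read off σ(i, j, k).
module Submission where

open import Data.Empty using (⊥-elim)
open import Data.List using (List; []; _∷_; _++_; map; applyUpTo; length; concat; concatMap)
open import Data.List.Membership.Propositional using (_∈_)
open import Data.List.Properties using (map-++; ++-assoc; concat-++; map-applyUpTo)
open import Data.List.Relation.Binary.Disjoint.Propositional using (Disjoint)
open import Data.List.Relation.Binary.Permutation.Propositional using (_↭_; ↭-refl; ↭-swap; ↭-sym)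
open import Data.List.Relation.Binary.Permutation.Propositional.Properties using (∈-resp-↭)
open import Data.List.Relation.Unary.All as All using (All; []; _∷_)
import Data.List.Relation.Unary.All.Properties as All
open import Data.List.Relation.Unary.AllPairs using ([]; _∷_)
import Data.List.Relation.Unary.AllPairs.Properties as AllPairs
open import Data.List.Relation.Unary.Any using (here; there)
open import Data.List.Relation.Unary.Unique.Propositional using (Unique)
import Data.List.Relation.Unary.Unique.Propositional.Properties as Unique
open import Data.Nat
  using (ℕ; zero; suc; pred; _≟_; _+_; _∸_; _<_; _≤_; z≤n; s≤s; z<s; s<s; NonZero; >-nonZero⁻¹)
open import Data.Nat.ListAction using (sum)
open import Data.Nat.Properties
open import Algebra.Properties.CommutativeSemigroup +-commutativeSemigroup using (xy∙z≈xz∙y; x∙yz≈y∙xz)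
open import Data.Product using (_,_; _×_; proj₁; proj₂; map₁)
open import Data.Sum using (inj₁; inj₂)
open import Data.Unit using (tt)
open import Function using (_∘_)
open import Relation.Binary.PropositionalEquality
open import Relation.Nullary using (yes; no; ¬_)

open import Defs

block : ℕ → ℕ → List ℕ
block a zero    = []
block a (suc d) = suc a ∷ block (suc a) d

length-block : ∀ a d → length (block a d) ≡ d
length-block a zero    = refl
length-block a (suc d) = cong suc (length-block (suc a) d)

block-++ : ∀ a d e → block a d ++ block (a + d) e ≡ block a (d + e)
block-++ a zero    e = cong (λ b → block b e) (+-identityʳ a)
block-++ a (suc d) e =
  cong (suc a ∷_) (trans (cong (λ b → block (suc a) d ++ block b e) (+-suc a d)) (block-++ (suc a) d e))

applyUpTo-block : ∀ a (f : ℕ → ℕ) d → (∀ t → f t ≡ suc (a + t)) → applyUpTo f d ≡ block a d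
applyUpTo-block a f zero    f≗ = refl
applyUpTo-block a f (suc d) f≗ =
  cong₂ _∷_ (trans (f≗ 0) (cong suc (+-identityʳ a)))
            (applyUpTo-block (suc a) (λ t → f (suc t)) d
                             (λ t → trans (f≗ (suc t)) (cong suc (+-suc a t))))

interval≡block : ∀ a b → interval a b ≡ block a (b ∸ a)
interval≡block a b = applyUpTo-block a _ (b ∸ a) (λ _ → refl)

interval-∷ : ∀ {a b} → a < b → interval a b ≡ suc a ∷ interval (suc a) b
interval-∷ {a} {suc b} (s≤s a≤b) = begin
  interval a (suc b)                 ≡⟨ interval≡block a (suc b) ⟩
  block a (suc b ∸ a)                ≡⟨ cong (block a) (+-∸-assoc 1 a≤b) ⟩
  suc a ∷ block (suc a) (b ∸ a)      ≡⟨ cong (suc a ∷_) (interval≡block (suc a) (suc b)) ⟨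
  suc a ∷ interval (suc a) (suc b)   ∎
  where open ≡-Reasoning

-- The sum of the first u weights, written without a trailing + 0 so that offsets of
-- concrete weight lists such as (l ∷ 1 ∷ 1 ∷ 1 ∷ r ∷ []) normalise to l + 2, l + 3, … .
offset : List ℕ → ℕ → ℕ
offset []       _             = 0
offset (w ∷ ws) zero          = 0
offset (w ∷ ws) (suc zero)    = w
offset (w ∷ ws) (suc (suc u)) = w + offset ws (suc u)

offset-zero : ∀ ws → offset ws 0 ≡ 0
offset-zero []      = refl
offset-zero (_ ∷ _) = refl

offset-∷ : ∀ w ws u → offset (w ∷ ws) (suc u) ≡ w + offset ws u
offset-∷ w ws zero    = sym (trans (cong (w +_) (offset-zero ws)) (+-identityʳ w))
offset-∷ w ws (suc u) = refl

offset-suc : ∀ ws u → offset ws (suc u) ≡ offset ws u + at ws (suc u)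
offset-suc []       u       = refl
offset-suc (w ∷ ws) zero    = refl
offset-suc (w ∷ ws) (suc u) = begin
  w + offset ws (suc u)                  ≡⟨ cong (w +_) (offset-suc ws u) ⟩
  w + (offset ws u + at ws (suc u))      ≡⟨ +-assoc w _ _ ⟨
  w + offset ws u + at ws (suc u)        ≡⟨ cong (_+ at ws (suc u)) (offset-∷ w ws u) ⟨
  offset (w ∷ ws) (suc u) + at ws (suc u) ∎
  where open ≡-Reasoning

offset-≤-suc : ∀ ws u → offset ws u ≤ offset ws (suc u)
offset-≤-suc ws u = ≤-trans (m≤m+n _ _) (≤-reflexive (sym (offset-suc ws u)))

offset-mono : ∀ ws {u v} → u ≤ v → offset ws u ≤ offset ws v
offset-mono ws {v = zero}  z≤n = ≤-refl
offset-mono ws {v = suc v} u≤1+v with m≤n⇒m<n∨m≡n u≤1+v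
... | inj₁ (s≤s u≤v) = ≤-trans (offset-mono ws u≤v) (offset-≤-suc ws v)
... | inj₂ refl      = ≤-refl

offset-strict : ∀ ws {u v} → u < v → .{{NonZero (at ws v)}} → offset ws u < offset ws v
offset-strict ws {u} {suc v} (s≤s u≤v) = begin-strict
  offset ws u                  ≤⟨ offset-mono ws u≤v ⟩
  offset ws v                  <⟨ m<m+n _ (>-nonZero⁻¹ _) ⟩
  offset ws v + at ws (suc v)  ≡⟨ offset-suc ws v ⟨
  offset ws (suc v)            ∎
  where open ≤-Reasoning

-- Inflation

-- inflate ws π replaces each value u of π by the block of at ws u consecutive values
-- following the blocks of 1, …, u − 1; its position blocks have the sizes ws ∘ₚ π.
blockOf : List ℕ → ℕ → List ℕ
blockOf ws u = block (offset ws (pred u)) (at ws u)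

inflate : List ℕ → Perm → Perm
inflate ws []      = []
inflate ws (u ∷ π) = blockOf ws u ++ inflate ws π

inflate-++ : ∀ ws π ρ → inflate ws (π ++ ρ) ≡ inflate ws π ++ inflate ws ρ
inflate-++ ws []      ρ = refl
inflate-++ ws (u ∷ π) ρ =
  trans (cong (blockOf ws u ++_) (inflate-++ ws π ρ)) (sym (++-assoc (blockOf ws u) _ _))

map-at-∷ : ∀ y xs a d → map (at (y ∷ xs)) (block (suc a) d) ≡ map (at xs) (block a d)
map-at-∷ y xs a zero    = refl
map-at-∷ y xs a (suc d) = cong (at xs (suc a) ∷_) (map-at-∷ y xs (suc a) d)

map-at-++ : ∀ L M a d → map (at (L ++ M)) (block (length L + a) d) ≡ map (at M) (block a d)
map-at-++ []      M a d = refl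
map-at-++ (y ∷ L) M a d = trans (map-at-∷ y (L ++ M) (length L + a) d) (map-at-++ L M a d)

map-at-prefix : ∀ L M → map (at (L ++ M)) (block 0 (length L)) ≡ L
map-at-prefix []      M = refl
map-at-prefix (y ∷ L) M = cong (y ∷_) (trans (map-at-∷ y (L ++ M) 0 (length L)) (map-at-prefix L M))

blockOf-zero : ∀ ws → blockOf ws 0 ≡ []
blockOf-zero []      = refl
blockOf-zero (_ ∷ _) = refl

-- For u out of range both sides are empty, because at returns 0 there.
map-at-inflate : ∀ ws π u → map (at (inflate ws π)) (blockOf (ws ∘ₚ π) u) ≡ blockOf ws (at π u)
map-at-inflate ws []      u    = sym (blockOf-zero ws)
map-at-inflate ws (x ∷ π) zero = sym (blockOf-zero ws)
map-at-inflate ws (x ∷ π) (suc zero) = begin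
  map (at I) (block 0 w)           ≡⟨ cong (map (at I) ∘ block 0) (length-block _ w) ⟨
  map (at I) (block 0 (length B))  ≡⟨ map-at-prefix B (inflate ws π) ⟩
  B                                ∎
  where
  open ≡-Reasoning
  B = blockOf ws x
  I = B ++ inflate ws π
  w = at ws x
map-at-inflate ws (x ∷ π) (suc (suc u)) = begin
  map (at I) (block (offset (ws ∘ₚ (x ∷ π)) (suc u)) d)
    ≡⟨ cong (λ o → map (at I) (block o d)) (offset-∷ w _ u) ⟩
  map (at I) (block (w + o) d)
    ≡⟨ cong (λ v → map (at I) (block (v + o) d)) (length-block _ w) ⟨
  map (at I) (block (length B + o) d)
    ≡⟨ map-at-++ B (inflate ws π) o d ⟩
  map (at (inflate ws π)) (blockOf (ws ∘ₚ π) (suc u))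
    ≡⟨ map-at-inflate ws π (suc u) ⟩
  blockOf ws (at π (suc u)) ∎
  where
  open ≡-Reasoning
  B = blockOf ws x
  I = B ++ inflate ws π
  w = at ws x
  o = offset (ws ∘ₚ π) u
  d = at (ws ∘ₚ π) (suc u)

inflate-∘ₚ : ∀ ws π s → inflate ws π ∘ₚ inflate (ws ∘ₚ π) s ≡ inflate ws (π ∘ₚ s)
inflate-∘ₚ ws π []      = refl
inflate-∘ₚ ws π (u ∷ s) =
  trans (map-++ (at (inflate ws π)) (blockOf (ws ∘ₚ π) u) _)
        (cong₂ _++_ (map-at-inflate ws π u) (inflate-∘ₚ ws π s))

weight : List ℕ → ℕ → ℕ → ℕ
weight ws p d = sum (ws ∘ₚ block p d)

inflate-block : ∀ ws p d → inflate ws (block p d) ≡ block (offset ws p) (weight ws p d)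
inflate-block ws p zero    = refl
inflate-block ws p (suc d) = begin
  block (offset ws p) (at ws (suc p)) ++ inflate ws (block (suc p) d)
    ≡⟨ cong (block (offset ws p) (at ws (suc p)) ++_) (inflate-block ws (suc p) d) ⟩
  block (offset ws p) (at ws (suc p)) ++ block (offset ws (suc p)) (weight ws (suc p) d)
    ≡⟨ cong (λ o → block (offset ws p) (at ws (suc p)) ++ block o (weight ws (suc p) d))
            (offset-suc ws p) ⟩
  block (offset ws p) (at ws (suc p)) ++ block (offset ws p + at ws (suc p)) (weight ws (suc p) d)
    ≡⟨ block-++ (offset ws p) (at ws (suc p)) (weight ws (suc p) d) ⟩
  block (offset ws p) (weight ws p (suc d)) ∎
  where open ≡-Reasoning

offset-+ : ∀ ws p d → offset ws (p + d) ≡ offset ws p + weight ws p d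
offset-+ ws p zero    = trans (cong (offset ws) (+-identityʳ p)) (sym (+-identityʳ (offset ws p)))
offset-+ ws p (suc d) = begin
  offset ws (p + suc d)                              ≡⟨ cong (offset ws) (+-suc p d) ⟩
  offset ws (suc p + d)                              ≡⟨ offset-+ ws (suc p) d ⟩
  offset ws (suc p) + weight ws (suc p) d            ≡⟨ cong (_+ weight ws (suc p) d) (offset-suc ws p) ⟩
  offset ws p + at ws (suc p) + weight ws (suc p) d  ≡⟨ +-assoc (offset ws p) _ _ ⟩
  offset ws p + weight ws p (suc d)                  ∎
  where open ≡-Reasoning

inflate-interval : ∀ ws p q → inflate ws (interval p q) ≡ interval (offset ws p) (offset ws q)
inflate-interval ws p q with ≤-total p q
... | inj₁ p≤q = begin
  inflate ws (interval p q)            ≡⟨ cong (inflate ws) (interval≡block p q) ⟩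
  inflate ws (block p (q ∸ p))         ≡⟨ inflate-block ws p (q ∸ p) ⟩
  block P W                            ≡⟨ cong (block P) (m+n∸m≡n P W) ⟨
  block P (P + W ∸ P)                  ≡⟨ cong (λ o → block P (o ∸ P)) P+W≡Q ⟩
  block P (Q ∸ P)                      ≡⟨ interval≡block P Q ⟨
  interval P Q                         ∎
  where
  open ≡-Reasoning
  P = offset ws p
  Q = offset ws q
  W = weight ws p (q ∸ p)
  P+W≡Q : P + W ≡ Q
  P+W≡Q = trans (sym (offset-+ ws p (q ∸ p))) (cong (offset ws) (m+[n∸m]≡n p≤q))
... | inj₂ q≤p = begin
  inflate ws (interval p q)            ≡⟨ cong (inflate ws) (interval≡block p q) ⟩
  inflate ws (block p (q ∸ p))         ≡⟨ cong (λ d → inflate ws (block p d)) (m≤n⇒m∸n≡0 q≤p) ⟩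
  []                                   ≡⟨ cong (block P) (m≤n⇒m∸n≡0 (offset-mono ws q≤p)) ⟨
  block P (Q ∸ P)                      ≡⟨ interval≡block P Q ⟨
  interval P Q                         ∎
  where
  open ≡-Reasoning
  P = offset ws p
  Q = offset ws q

inflate-σ : ∀ ws a i j k →
            inflate ws (σ a i j k) ≡ σ (offset ws a) (offset ws i) (offset ws j) (offset ws k)
inflate-σ ws a i j k = begin
  inflate ws (I₁ ++ I₂ ++ I₃ ++ I₄)
    ≡⟨ inflate-++ ws I₁ _ ⟩
  inflate ws I₁ ++ inflate ws (I₂ ++ I₃ ++ I₄)
    ≡⟨ cong (inflate ws I₁ ++_) (inflate-++ ws I₂ _) ⟩
  inflate ws I₁ ++ inflate ws I₂ ++ inflate ws (I₃ ++ I₄)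
    ≡⟨ cong (λ r → inflate ws I₁ ++ inflate ws I₂ ++ r) (inflate-++ ws I₃ _) ⟩
  inflate ws I₁ ++ inflate ws I₂ ++ inflate ws I₃ ++ inflate ws I₄
    ≡⟨ cong₂ _++_ inflate-I₁ (cong₂ _++_ (inflate-interval ws j k)
                               (cong₂ _++_ (inflate-interval ws i j) (inflate-interval ws k a))) ⟩
  σ (offset ws a) (offset ws i) (offset ws j) (offset ws k) ∎
  where
  open ≡-Reasoning
  I₁ = interval 0 i
  I₂ = interval j k
  I₃ = interval i j
  I₄ = interval k a
  inflate-I₁ : inflate ws I₁ ≡ interval 0 (offset ws i)
  inflate-I₁ = trans (inflate-interval ws 0 i) (cong (λ o → interval o (offset ws i)) (offset-zero ws))

inflate-edge : ∀ ws π₀ {a i j k} → i < j → j < k → k ≤ a →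
               .{{NonZero (at (ws ∘ₚ π₀) j)}} → .{{NonZero (at (ws ∘ₚ π₀) k)}} →
               CayAdj (offset (ws ∘ₚ π₀) a) (inflate ws π₀) (inflate ws (π₀ ∘ₚ σ a i j k))
inflate-edge ws π₀ {a} {i} {j} {k} i<j j<k k≤a =
  inflate ws′ (σ a i j k) ,
  (offset ws′ i , offset ws′ j , offset ws′ k ,
   offset-strict ws′ i<j , offset-strict ws′ j<k , offset-mono ws′ k≤a , inflate-σ ws′ a i j k) ,
  sym (inflate-∘ₚ ws π₀ (σ a i j k))
  where ws′ = ws ∘ₚ π₀

inflate-σ-edge : ∀ ws a i₀ j₀ k₀ i j k i₁ j₁ k₁ → σ a i₀ j₀ k₀ ∘ₚ σ a i j k ≡ σ a i₁ j₁ k₁ →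
  i < j → j < k → k ≤ a →
  .{{NonZero (at (ws ∘ₚ σ a i₀ j₀ k₀) j)}} → .{{NonZero (at (ws ∘ₚ σ a i₀ j₀ k₀) k)}} →
  CayAdj (offset (ws ∘ₚ σ a i₀ j₀ k₀) a)
         (σ (offset ws a) (offset ws i₀) (offset ws j₀) (offset ws k₀))
         (σ (offset ws a) (offset ws i₁) (offset ws j₁) (offset ws k₁))
inflate-σ-edge ws a i₀ j₀ k₀ i j k i₁ j₁ k₁ π₀∘s₀≡ρ₀ i<j j<k k≤a =
  subst₂ (CayAdj _) (inflate-σ ws a i₀ j₀ k₀)
                    (trans (cong (inflate ws) π₀∘s₀≡ρ₀) (inflate-σ ws a i₁ j₁ k₁))
                    (inflate-edge ws (σ a i₀ j₀ k₀) i<j j<k k≤a)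

rung-adj : ∀ {n l} → 3 + l ≤ n → CayAdj n (σ n l (l + 2) (l + 3)) (σ n l (l + 1) (l + 3))
rung-adj {n} {l} 3+l≤n with m≤n⇒∃[o]m+o≡n 3+l≤n
... | r , 3+l+r≡n =
  subst (λ x → CayAdj x (σ x l (l + 2) (l + 3)) (σ x l (l + 1) (l + 3)))
    (trans (x∙yz≈y∙xz l 3 r) 3+l+r≡n)
    (inflate-σ-edge (l ∷ 1 ∷ 1 ∷ 1 ∷ r ∷ []) 5  1 3 4  1 3 4  1 2 4
                    refl (s<s z<s) (n<1+n 3) (n≤1+n 4))

step-adj : ∀ {n l} → 4 + l ≤ n → CayAdj n (σ n l (l + 1) (l + 3)) (σ n (suc l) (suc l + 2) (suc l + 3))
step-adj {n} {l} 4+l≤n with m≤n⇒∃[o]m+o≡n 4+l≤n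
... | r , 4+l+r≡n =
  subst₂ (λ x y → CayAdj x (σ x l (l + 1) (l + 3)) (σ x y (suc l + 2) (suc l + 3)))
    (trans (x∙yz≈y∙xz l 4 r) 4+l+r≡n) (+-comm l 1)
    (subst₂ (λ y z → CayAdj N (σ N l (l + 1) (l + 3)) (σ N (l + 1) y z)) (+-suc l 2) (+-suc l 3)
      (inflate-σ-edge (l ∷ 1 ∷ 2 ∷ 1 ∷ r ∷ []) 5  1 2 3  1 2 4  2 3 4
                      refl (n<1+n 1) (s<s (s<s z<s)) (n≤1+n 4)))
  where N = l + (4 + r)

closing-path : ∀ m → let n = 5 + m in
  Chain (CayAdj n) (σ n (2 + m) (2 + m + 1) (2 + m + 3) ∷ σ n 0 (3 + m) n ∷ σ n 0 (3 + m) (4 + m) ∷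
                    σ n 0 1 (4 + m) ∷ σ n 1 (4 + m) n ∷ σ n 1 2 n ∷ σ n 0 2 n ∷ σ n 0 2 3 ∷ [])
-- Each adjacency is the inflation of one in Sym₃ or Sym₄; the substitutions only bring
-- sums such as 2 + m + 3 into the form 5 + m.
closing-path m =
  subst₂ (λ x y → CayAdj x (σ x (2 + m) (2 + m + 1) (2 + m + 3)) (σ x 0 y x))
    (c+m+d≡c+d+m 2 3) (c+m+d≡c+d+m 2 1)
    (inflate-σ-edge (2 + m ∷ 1 ∷ 2 ∷ []) 3  1 2 3  0 1 2  0 2 3  refl z<s (n<1+n 1) (n≤1+n 2)) ,
  subst₂ (λ x y → CayAdj (5 + m) (σ x 0 (3 + m) x) (σ x 0 (3 + m) y))
    (c+m+d≡c+d+m 3 2) (c+m+d≡c+d+m 3 1)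
    (inflate-σ-edge (3 + m ∷ 1 ∷ 1 ∷ []) 3  0 1 3  1 2 3  0 1 2  refl (n<1+n 1) (n<1+n 2) ≤-refl) ,
  subst₂ (λ y z → CayAdj (suc z) (σ y 0 (3 + m) z) (σ y 0 1 z))
    (cong (1 +_) (c+m+d≡c+d+m 2 2)) (cong (1 +_) (c+m+d≡c+d+m 2 1))
    (inflate-σ-edge (1 ∷ 2 + m ∷ 1 ∷ 1 ∷ []) 4  0 2 3  0 2 3  0 1 3  refl z<s (n<1+n 2) (n≤1+n 3)) ,
  subst₂ (λ x y → CayAdj x (σ y 0 1 (4 + m)) (σ y 1 (4 + m) y))
    (c+m+d≡c+d+m 3 2) (cong (1 +_) (c+m+d≡c+d+m 3 1))
    (inflate-σ-edge (1 ∷ 3 + m ∷ 1 ∷ []) 3  0 1 2  0 1 3  1 2 3  refl z<s (s<s z<s) ≤-refl) ,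
  subst (λ y → CayAdj (5 + m) (σ y 1 (4 + m) y) (σ y 1 2 y))
    (cong (2 +_) (c+m+d≡c+d+m 2 1))
    (inflate-σ-edge (1 ∷ 1 ∷ 2 + m ∷ 1 ∷ []) 4  1 3 4  1 3 4  1 2 4  refl (s<s z<s) (n<1+n 3) ≤-refl) ,
  subst (λ x → CayAdj x (σ (5 + m) 1 2 (5 + m)) (σ (5 + m) 0 2 (5 + m)))
    (cong (1 +_) (c+m+d≡c+d+m 3 1))
    (inflate-σ-edge (1 ∷ 1 ∷ 3 + m ∷ []) 3  1 2 3  0 1 2  0 2 3  refl z<s (n<1+n 1) (n≤1+n 2)) ,
  subst (λ x → CayAdj x (σ (5 + m) 0 2 (5 + m)) (σ (5 + m) 0 2 3))
    (cong (1 +_) (c+m+d≡c+d+m 2 2))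
    (inflate-σ-edge (2 ∷ 1 ∷ 2 + m ∷ []) 3  0 1 3  1 2 3  0 1 2  refl (n<1+n 1) (n<1+n 2) ≤-refl) ,
  tt
  where
  c+m+d≡c+d+m : ∀ c d → c + m + d ≡ c + d + m
  c+m+d≡c+d+m c d = xy∙z≈xz∙y c m d

ladderEdge : ℕ → ℕ → Perm × Perm
ladderEdge n l = σ n l (l + 1) (l + 3) , σ n l (l + 2) (l + 3)

closingEdges : ℕ → List (Perm × Perm)
closingEdges n = (σ n 0 (n ∸ 2) (n ∸ 1) , σ n 0 (n ∸ 2) n)
               ∷ (σ n 1 (n ∸ 1) n , σ n 0 1 (n ∸ 1))
               ∷ (σ n 0 2 n , σ n 1 2 n)
               ∷ []

flipped : ∀ {A : Set} → List (A × A) → List A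
flipped = concatMap (λ p → proj₂ p ∷ proj₁ p ∷ [])

flipped-++ : ∀ {A : Set} (ps qs : List (A × A)) → flipped (ps ++ qs) ≡ flipped ps ++ flipped qs
flipped-++ ps qs = trans (cong concat (map-++ _ ps qs)) (sym (concat-++ (map _ ps) (map _ qs)))

flipped↭concatMap : ∀ {A : Set} {f : A × A → List A} → (∀ a b → f (a , b) ≡ a ∷ b ∷ []) →
                    ∀ ps → flipped ps ↭ concatMap f ps
flipped↭concatMap f-pair []            = ↭-refl
flipped↭concatMap f-pair ((a , b) ∷ ps) rewrite f-pair a b = ↭-swap b a (flipped↭concatMap f-pair ps)

flipped-applyUpTo : ∀ {A : Set} (f : ℕ → A × A) k →
                    flipped (applyUpTo f k) ≡ concat (applyUpTo (λ t → proj₂ (f t) ∷ proj₁ (f t) ∷ []) k)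
flipped-applyUpTo f k = cong concat (map-applyUpTo f _ k)

chain-ladder : ∀ {R : Perm → Perm → Set} (f : ℕ → Perm × Perm) d {ys} →
               (∀ t → t ≤ d → R (proj₂ (f t)) (proj₁ (f t))) →
               (∀ t → t < d → R (proj₁ (f t)) (proj₂ (f (suc t)))) →
               Chain R (proj₁ (f d) ∷ ys) →
               Chain R (flipped (applyUpTo f (suc d)) ++ ys)
chain-ladder f zero    rung step exit = rung 0 z≤n , exit
chain-ladder f (suc d) rung step exit =
  rung 0 z≤n , step 0 z<s ,
  chain-ladder (λ t → f (suc t)) d (λ t t≤d → rung (suc t) (s≤s t≤d))
                                   (λ t t<d → step (suc t) (s≤s t<d)) exit

-- Distinctness of the vertices

run : ℕ → List ℕ → ℕ × List ℕ
run c []       = 0 , []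
run c (x ∷ xs) with x ≟ suc c
... | yes _ = map₁ suc (run (suc c) xs)
... | no  _ = 0 , x ∷ xs

run-block : ∀ a d {y ys} → y ≢ suc (a + d) → run a (block a d ++ y ∷ ys) ≡ (d , y ∷ ys)
run-block a zero {y} y≢ with y ≟ suc a
... | yes y≡ = ⊥-elim (y≢ (trans y≡ (cong suc (sym (+-identityʳ a)))))
... | no  _  = refl
run-block a (suc d) y≢ with suc a ≟ suc a
... | yes _   = cong (map₁ suc) (run-block (suc a) d (λ y≡ → y≢ (trans y≡ (cong suc (sym (+-suc a d))))))
... | no  a≢a = ⊥-elim (a≢a refl)

Shape : Set
Shape = ℕ × ℕ × ℕ

-- On σ(i, j, k): the initial run 1, …, i has length i, and the next entry j + 1 starts
-- the run j + 1, …, k.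
readShape : ℕ × List ℕ → Shape
readShape (i , [])     = i , 0 , 0
readShape (i , y ∷ ys) = i , pred y , pred y + proj₁ (run (pred y) (y ∷ ys))

shape : Perm → Shape
shape π = readShape (run 0 π)

shape-σ : ∀ n {i j k} → i < j → j < k → shape (σ n i j k) ≡ (i , j , k)
shape-σ n {i} {j} {k} i<j j<k = begin
  readShape (run 0 (interval 0 i ++ interval j k ++ interval i j ++ R))
    ≡⟨ cong (λ xs → readShape (run 0 (xs ++ interval j k ++ interval i j ++ R))) (interval≡block 0 i) ⟩
  readShape (run 0 (block 0 i ++ interval j k ++ interval i j ++ R))
    ≡⟨ cong (λ xs → readShape (run 0 (block 0 i ++ xs ++ interval i j ++ R))) (interval-∷ j<k) ⟩
  readShape (run 0 (block 0 i ++ suc j ∷ interval (suc j) k ++ interval i j ++ R))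
    ≡⟨ cong readShape (run-block 0 i (λ j≡i → <⇒≢ i<j (sym (suc-injective j≡i)))) ⟩
  (i , j , j + proj₁ (run j ((suc j ∷ interval (suc j) k) ++ interval i j ++ R)))
    ≡⟨ cong (λ xs → (i , j , j + proj₁ (run j (xs ++ interval i j ++ R))))
            (trans (sym (interval-∷ j<k)) (interval≡block j k)) ⟩
  (i , j , j + proj₁ (run j (block j (k ∸ j) ++ interval i j ++ R)))
    ≡⟨ cong (λ xs → (i , j , j + proj₁ (run j (block j (k ∸ j) ++ xs ++ R)))) (interval-∷ i<j) ⟩
  (i , j , j + proj₁ (run j (block j (k ∸ j) ++ suc i ∷ interval (suc i) j ++ R)))
    ≡⟨ cong (λ r → (i , j , j + proj₁ r)) (run-block j (k ∸ j) i≢k) ⟩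
  (i , j , j + (k ∸ j))
    ≡⟨ cong (λ k′ → (i , j , k′)) (m+[n∸m]≡n (<⇒≤ j<k)) ⟩
  (i , j , k) ∎
  where
  open ≡-Reasoning
  R = interval k n
  i≢k : suc i ≢ suc (j + (k ∸ j))
  i≢k i≡k = <⇒≢ (<-trans i<j j<k) (trans (suc-injective i≡k) (m+[n∸m]≡n (<⇒≤ j<k)))

Width3 : Shape → Set
Width3 (i , _ , k) = k ≡ i + 3

shape-ladderEdge : ∀ n t → shape (proj₁ (ladderEdge n t)) ≡ (t , t + 1 , t + 3)
                         × shape (proj₂ (ladderEdge n t)) ≡ (t , t + 2 , t + 3)
shape-ladderEdge n t = shape-σ n (m<m+n t z<s) (+-monoʳ-< t (s<s z<s)) ,
                       shape-σ n (m<m+n t z<s) (+-monoʳ-< t (n<1+n 2))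

ladder-unique : ∀ n k → Unique (flipped (applyUpTo (ladderEdge n) k))
ladder-unique n k = subst Unique (sym (flipped-applyUpTo (ladderEdge n) k))
  (Unique.concat⁺ (All.applyUpTo⁺₂ _ k (λ t → (rung-injective t ∷ []) ∷ [] ∷ []))
                  (AllPairs.applyUpTo⁺₁ _ k rungs-disjoint))
  where
  rung : ℕ → List Perm
  rung t = proj₂ (ladderEdge n t) ∷ proj₁ (ladderEdge n t) ∷ []

  rung-injective : ∀ t → proj₂ (ladderEdge n t) ≢ proj₁ (ladderEdge n t)
  rung-injective t b≡a = 1+n≢n (+-cancelˡ-≡ t 2 1 (cong (proj₁ ∘ proj₂) shape-b≡shape-a))
    where
    shape-b≡shape-a = trans (sym (proj₂ (shape-ladderEdge n t)))
                            (trans (cong shape b≡a) (proj₁ (shape-ladderEdge n t)))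

  level : ∀ t {v} → v ∈ rung t → proj₁ (shape v) ≡ t
  level t (here refl)         = cong proj₁ (proj₂ (shape-ladderEdge n t))
  level t (there (here refl)) = cong proj₁ (proj₁ (shape-ladderEdge n t))

  rungs-disjoint : ∀ {t u} → t < u → u < k → Disjoint (rung t) (rung u)
  rungs-disjoint t<u _ (v∈t , v∈u) = <⇒≢ t<u (trans (sym (level _ v∈t)) (level _ v∈u))

ladder-width3 : ∀ n k → All (Width3 ∘ shape) (flipped (applyUpTo (ladderEdge n) k))
ladder-width3 n k = subst (All (Width3 ∘ shape)) (sym (flipped-applyUpTo (ladderEdge n) k))
  (All.concat⁺ (All.applyUpTo⁺₂ _ k λ t →
    width3 (proj₂ (ladderEdge n t)) (proj₂ (shape-ladderEdge n t)) ∷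
    width3 (proj₁ (ladderEdge n t)) (proj₁ (shape-ladderEdge n t)) ∷ []))
  where
  width3 : ∀ v {t j} → shape v ≡ (t , j , t + 3) → Width3 (shape v)
  width3 v shape-v = subst Width3 (sym shape-v) refl

closing-shapes : ∀ m → map shape (flipped (closingEdges (5 + m)))
                     ≡ (0 , 3 + m , 5 + m) ∷ (0 , 3 + m , 4 + m) ∷ (0 , 1 , 4 + m)
                     ∷ (1 , 4 + m , 5 + m) ∷ (1 , 2 , 5 + m) ∷ (0 , 2 , 5 + m) ∷ []
closing-shapes m =
  cong₂ _∷_ (shape-σ n z<s (m<n+m (3 + m) {2} z<s)) (
  cong₂ _∷_ (shape-σ n z<s (n<1+n (3 + m))) (
  cong₂ _∷_ (shape-σ n z<s (s<s z<s)) (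
  cong₂ _∷_ (shape-σ n (s<s z<s) (n<1+n (4 + m))) (
  cong₂ _∷_ (shape-σ n (n<1+n 1) (s<s (s<s z<s))) (
  cong₂ _∷_ (shape-σ n z<s (s<s (s<s z<s))) refl)))))
  where n = 5 + m

closing-unique : ∀ m → Unique (flipped (closingEdges (5 + m)))
closing-unique m = Unique.map⁻ {f = shape} (subst Unique (sym (closing-shapes m))
  (((λ ()) ∷ (λ ()) ∷ (λ ()) ∷ (λ ()) ∷ (λ ()) ∷ []) ∷
   ((λ ()) ∷ (λ ()) ∷ (λ ()) ∷ (λ ()) ∷ []) ∷
   ((λ ()) ∷ (λ ()) ∷ (λ ()) ∷ []) ∷
   ((λ ()) ∷ (λ ()) ∷ []) ∷
   ((λ ()) ∷ []) ∷ [] ∷ []))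

closing-not-width3 : ∀ m → All (¬_ ∘ Width3 ∘ shape) (flipped (closingEdges (5 + m)))
closing-not-width3 m = All.map⁻ {f = shape} (subst (All (¬_ ∘ Width3)) (sym (closing-shapes m))
  ((λ ()) ∷ (λ ()) ∷ (λ ()) ∷ (λ ()) ∷ (λ ()) ∷ (λ ()) ∷ []))

hamiltonian : ∀ m → Hamiltonian (CayAdj (5 + m)) (Vset (5 + m))
hamiltonian m =
  cycle , s≤s (s≤s (s≤s z≤n)) , cycle-unique ,
  (λ _ → ∈-resp-↭ cycle↭V) , (λ _ → ∈-resp-↭ (↭-sym cycle↭V)) ,
  cycle-closed
  where
  n = 5 + m
  ladder = flipped (applyUpTo (ladderEdge n) (3 + m))
  closing = flipped (closingEdges n)
  cycle = flipped (edges n)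

  cycle↭V : cycle ↭ Vset n
  cycle↭V = flipped↭concatMap (λ _ _ → refl) (edges n)

  cycle≡ : cycle ≡ ladder ++ closing
  cycle≡ = flipped-++ (applyUpTo (ladderEdge n) (3 + m)) (closingEdges n)

  cycle-unique : Unique cycle
  cycle-unique = subst Unique (sym cycle≡)
    (Unique.++⁺ (ladder-unique n (3 + m)) (closing-unique m) ladder#closing)
    where
    ladder#closing : Disjoint ladder closing
    ladder#closing (v∈ladder , v∈closing) =
      All.lookup (closing-not-width3 m) v∈closing (All.lookup (ladder-width3 n (3 + m)) v∈ladder)

  -- take 1 cycle computes to σ n 0 2 3 ∷ [].
  cycle-closed : Chain (CayAdj n) (cycle ++ σ n 0 2 3 ∷ [])
  cycle-closed = subst (Chain (CayAdj n))
    (sym (trans (cong (_++ σ n 0 2 3 ∷ []) cycle≡) (++-assoc ladder closing _)))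
    (chain-ladder (ladderEdge n) (2 + m)
      (λ t t≤2+m → rung-adj (s≤s (s≤s (s≤s t≤2+m))))
      (λ t t<2+m → step-adj (s≤s (s≤s (s≤s t<2+m))))
      (closing-path m))

proposition7 : (n : ℕ) → 5 ≤ n → Hamiltonian (CayAdj n) (Vset n)
proposition7 (suc (suc (suc (suc (suc m))))) (s≤s (s≤s (s≤s (s≤s (s≤s z≤n))))) = hamiltonian m
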